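{- Let $(\sigma_0,\sigma_1,\dots,\sigma_t)$ be a sequence of swaps and let $o_a,o_b$ be two objects with $a<b$. Let $a'=\sigma_t^T(o_a)$ and $b'=\sigma_t^T(o_b)$. If $a'\le a$ or $b'\ge b$, then $a'<b'$.
   Context: Agents $N=\{1,\dots,n\}$ lie on a path in this order (edges between $i$ and $i+1$); objects $O=\{o_1,\dots,o_n\}$; each agent $i$ has a strict preference $\succ_i$ (a linear order on $O$); the initial assignment is $\sigma_0(i)=o_i$. A swap exchanges the objects of two adjacent agents $i,i+1$ in an assignment $\sigma$ and is allowed only if $\sigma(i+1)\succ_i\sigma(i)$ and $\sigma(i)\succ_{i+1}\sigma(i+1)$. A sequence of swaps $(\sigma_0,\dots,\sigma_t)$ starts at the initial assignment and each $\sigma_r$ arises from $\sigma_{r-1}$ by an allowed swap. $\sigma^T(o)$ denotes the agent holding $o$ in $\sigma$. -}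

module Defs where

open import Data.Nat using (ℕ; suc)
open import Data.Fin using (Fin; toℕ; _≟_)
open import Data.List using (List; []; _∷_)
open import Relation.Binary.PropositionalEquality using (_≡_)
open import Relation.Binary.Structures using (IsStrictTotalOrder)
open import Relation.Nullary using (yes; no)

-- Agents and objects are both indexed by Fin n; agent i (0-based) initially
-- holds object o_i.  Agents lie on a path: i is adjacent to i+1.

record Profile (n : ℕ) : Set₁ where
  field
    _≻[_]_ : Fin n → Fin n → Fin n → Set
    isSTO  : (i : Fin n) → IsStrictTotalOrder _≡_ (λ x y → x ≻[ i ] y)
open Profile public

-- An assignment: agent ↦ object held.
Assignment : ℕ → Set
Assignment n = Fin n → Fin n

σ₀ : {n : ℕ} → Assignment n
σ₀ i = i

swapAt : {n : ℕ} → Fin n → Fin n → Assignment n → Assignment n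
swapAt i j σ k with k ≟ i
... | yes _ = σ j
... | no _ with k ≟ j
...   | yes _ = σ i
...   | no _  = σ k

record AllowedSwap {n : ℕ} (P : Profile n) (σ σ' : Assignment n) : Set where
  field
    i j      : Fin n
    adjacent : toℕ j ≡ suc (toℕ i)
    pref-i   : _≻[_]_ P (σ j) i (σ i)
    pref-j   : _≻[_]_ P (σ i) j (σ j)
    result   : σ' ≡ swapAt i j σ

data SwapSeq {n : ℕ} (P : Profile n) : Assignment n → Set where
  start : SwapSeq P σ₀
  step  : {σ σ' : Assignment n} → SwapSeq P σ → AllowedSwap P σ σ' → SwapSeq P σ'

module Submission where

-- An agent i that an object has passed on its way from its origin gave it away for
-- something better, and agents only ever improve, so i strictly prefers its current
-- object to it and will never take it back.  Hence an object moving right is at or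
-- right of its origin, and one moving left is at or left of its origin.  Swapping two
-- such objects into the wrong order therefore leaves the smaller one strictly right of
-- its origin and the larger one strictly left of its origin, and this stays true for
-- every pair in the wrong order.  The hypothesis  a' ≤ a ⊎ b' ≥ b  excludes exactly
-- that situation.

open import Defs
open import Data.Nat using (ℕ)
open import Data.Fin using (Fin; _<_; _≤_; _≥_)
open import Data.Sum using (_⊎_)
open import Relation.Binary.PropositionalEquality using (_≡_)

import Data.Nat as ℕ
import Data.Nat.Properties as ℕ
open import Data.Fin using (toℕ; _≟_; _<?_; _≤?_)
open import Data.Fin.Properties using (≤∧≢⇒<; <-irrefl; <-trans)
open import Data.Sum using (inj₁; inj₂; [_,_]′)
open import Data.Product using (_×_; _,_; proj₂)
open import Data.Empty using (⊥-elim)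
open import Function using (_∘_; _∘′_)
open import Relation.Nullary using (yes; no; ¬_)
open import Relation.Binary.PropositionalEquality using (_≢_; refl; sym; subst)
open import Relation.Binary.Structures using (IsStrictTotalOrder)

private
  variable
    n : ℕ

swapAt-left : (i j : Fin n) (σ : Assignment n) → swapAt i j σ i ≡ σ j
swapAt-left i j σ with i ≟ i
... | yes _  = refl
... | no i≢i = ⊥-elim (i≢i refl)

swapAt-right : (i j : Fin n) (σ : Assignment n) → j ≢ i → swapAt i j σ j ≡ σ i
swapAt-right i j σ j≢i with j ≟ i
... | yes j≡i = ⊥-elim (j≢i j≡i)
... | no _ with j ≟ j
...   | yes _  = refl
...   | no j≢j = ⊥-elim (j≢j refl)

swapAt-other : (i j k : Fin n) (σ : Assignment n) → k ≢ i → k ≢ j → swapAt i j σ k ≡ σ k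
swapAt-other i j k σ k≢i k≢j with k ≟ i
... | yes k≡i = ⊥-elim (k≢i k≡i)
... | no _ with k ≟ j
...   | yes k≡j = ⊥-elim (k≢j k≡j)
...   | no _    = refl

data SwapView (i j : Fin n) : Fin n → Set where
  left  : SwapView i j i
  right : SwapView i j j
  other : ∀ {k} → k ≢ i → k ≢ j → SwapView i j k

swapView : (i j k : Fin n) → SwapView i j k
swapView i j k with k ≟ i
... | yes refl = left
... | no k≢i with k ≟ j
...   | yes refl = right
...   | no k≢j   = other k≢i k≢j

OnRoute : Fin n → Fin n → Fin n → Set
OnRoute o p i = (o ≤ i × i < p) ⊎ (p < i × i ≤ o)

OnRoute-irrefl : {o p : Fin n} → ¬ OnRoute o p p
OnRoute-irrefl (inj₁ (_ , p<p)) = <-irrefl refl p<p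
OnRoute-irrefl (inj₂ (p<p , _)) = <-irrefl refl p<p

OnRoute-empty : {p i : Fin n} → ¬ OnRoute p p i
OnRoute-empty (inj₁ (p≤i , i<p)) = ℕ.<⇒≱ i<p p≤i
OnRoute-empty (inj₂ (p<i , i≤p)) = ℕ.<⇒≱ p<i i≤p

module Invariants {n : ℕ} (P : Profile n) where

  _≻⟨_⟩_ : Fin n → Fin n → Fin n → Set
  x ≻⟨ i ⟩ y = _≻[_]_ P x i y

  ≻-trans : ∀ {i x y z} → x ≻⟨ i ⟩ y → y ≻⟨ i ⟩ z → x ≻⟨ i ⟩ z
  ≻-trans {i} = IsStrictTotalOrder.trans (isSTO P i)

  ≻-asym : ∀ {i x y} → x ≻⟨ i ⟩ y → ¬ y ≻⟨ i ⟩ x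
  ≻-asym {i} = IsStrictTotalOrder.asym (isSTO P i)

  -- Objects are named by their origins, so σ p is also the start of the route of
  -- the object held by p.
  RouteDominated : Assignment n → Set
  RouteDominated σ = ∀ p i → OnRoute (σ p) p i → σ i ≻⟨ i ⟩ σ p

  Crossed : Assignment n → Fin n → Fin n → Set
  Crossed σ p q = σ p < p × q < σ q

  InversionsCrossed : Assignment n → Set
  InversionsCrossed σ = ∀ p q → σ p < σ q → p < q ⊎ Crossed σ p q

  module AdjacentSwap (σ : Assignment n) (k j : Fin n) (adj : toℕ j ≡ ℕ.suc (toℕ k))
                      (pref-k : σ j ≻⟨ k ⟩ σ k) (pref-j : σ k ≻⟨ j ⟩ σ j)
                      (dominated : RouteDominated σ) where

    σ' : Assignment n
    σ' = swapAt k j σ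

    k<j : k < j
    k<j = subst (toℕ k ℕ.<_) (sym adj) (ℕ.n<1+n (toℕ k))

    j≢k : j ≢ k
    j≢k j≡k = <-irrefl (sym j≡k) k<j

    <j⇒≤k : {i : Fin n} → i < j → i ≤ k
    <j⇒≤k {i} i<j = ℕ.s≤s⁻¹ (subst (toℕ i ℕ.<_) adj i<j)

    k<⇒j≤ : {i : Fin n} → k < i → j ≤ i
    k<⇒j≤ {i} k<i = subst (ℕ._≤ toℕ i) (sym adj) k<i

    σk≤k : σ k ≤ k
    σk≤k with σ k ≤? k
    ... | yes σk≤k = σk≤k
    ... | no σk≰k  = ⊥-elim (≻-asym pref-j
                       (dominated k j (inj₂ (k<j , k<⇒j≤ (ℕ.≰⇒> σk≰k)))))

    k<σj : k < σ j
    k<σj with k <? σ j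
    ... | yes k<σj = k<σj
    ... | no k≮σj  = ⊥-elim (≻-asym pref-k
                       (dominated j k (inj₁ (ℕ.≮⇒≥ k≮σj , k<j))))

    OnRoute-extendʳ : {o i : Fin n} → i ≢ j → OnRoute o k i → OnRoute o j i
    OnRoute-extendʳ i≢j (inj₁ (o≤i , i<k)) = inj₁ (o≤i , <-trans i<k k<j)
    OnRoute-extendʳ i≢j (inj₂ (k<i , i≤o)) = inj₂ (≤∧≢⇒< (k<⇒j≤ k<i) (i≢j ∘ sym) , i≤o)

    OnRoute-extendˡ : {o i : Fin n} → i ≢ k → OnRoute o j i → OnRoute o k i
    OnRoute-extendˡ i≢k (inj₁ (o≤i , i<j)) = inj₁ (o≤i , ≤∧≢⇒< (<j⇒≤k i<j) i≢k)
    OnRoute-extendˡ i≢k (inj₂ (j<i , i≤o)) = inj₂ (<-trans k<j j<i , i≤o)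

    dominated′ : RouteDominated σ'
    dominated′ p i onRoute with swapView k j p | swapView k j i
    ... | left      | left  = ⊥-elim (OnRoute-irrefl onRoute)
    ... | right     | right = ⊥-elim (OnRoute-irrefl onRoute)
    ... | left      | right
      rewrite swapAt-left k j σ | swapAt-right k j σ j≢k = pref-j
    ... | right     | left
      rewrite swapAt-left k j σ | swapAt-right k j σ j≢k = pref-k
    ... | left      | other i≢k i≢j
      rewrite swapAt-left k j σ | swapAt-other k j i σ i≢k i≢j =
        dominated j i (OnRoute-extendʳ i≢j onRoute)
    ... | right     | other i≢k i≢j
      rewrite swapAt-right k j σ j≢k | swapAt-other k j i σ i≢k i≢j =
        dominated k i (OnRoute-extendˡ i≢k onRoute)
    ... | other p≢k p≢j | left
      rewrite swapAt-left k j σ | swapAt-other k j p σ p≢k p≢j =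
        ≻-trans pref-k (dominated p k onRoute)
    ... | other p≢k p≢j | right
      rewrite swapAt-right k j σ j≢k | swapAt-other k j p σ p≢k p≢j =
        ≻-trans pref-j (dominated p j onRoute)
    ... | other p≢k p≢j | other i≢k i≢j
      rewrite swapAt-other k j p σ p≢k p≢j | swapAt-other k j i σ i≢k i≢j =
        dominated p i onRoute

    crossed′ : InversionsCrossed σ → InversionsCrossed σ'
    crossed′ crossed p q σ'p<σ'q with swapView k j p | swapView k j q
    ... | left  | left  = ⊥-elim (<-irrefl refl σ'p<σ'q)
    ... | right | right = ⊥-elim (<-irrefl refl σ'p<σ'q)
    ... | left  | right = inj₁ k<j
    ... | right | left
      rewrite swapAt-left k j σ | swapAt-right k j σ j≢k =
        inj₂ (ℕ.≤-<-trans σk≤k k<j , k<σj)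
    ... | left  | other q≢k q≢j
      rewrite swapAt-left k j σ | swapAt-other k j q σ q≢k q≢j
      with crossed j q σ'p<σ'q
    ...   | inj₁ j<q          = inj₁ (<-trans k<j j<q)
    ...   | inj₂ (σj<j , _)   = ⊥-elim (ℕ.<⇒≱ k<σj (<j⇒≤k σj<j))
    crossed′ crossed p q σ'p<σ'q | right | other q≢k q≢j
      rewrite swapAt-right k j σ j≢k | swapAt-other k j q σ q≢k q≢j
      with crossed k q σ'p<σ'q
    ...   | inj₁ k<q          = inj₁ (≤∧≢⇒< (k<⇒j≤ k<q) (q≢j ∘ sym))
    ...   | inj₂ (σk<k , q<σq) = inj₂ (<-trans σk<k k<j , q<σq)
    crossed′ crossed p q σ'p<σ'q | other p≢k p≢j | left
      rewrite swapAt-left k j σ | swapAt-other k j p σ p≢k p≢j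
      with crossed p j σ'p<σ'q
    ...   | inj₁ p<j          = inj₁ (≤∧≢⇒< (<j⇒≤k p<j) p≢k)
    ...   | inj₂ (σp<p , _)   = inj₂ (σp<p , k<σj)
    crossed′ crossed p q σ'p<σ'q | other p≢k p≢j | right
      rewrite swapAt-right k j σ j≢k | swapAt-other k j p σ p≢k p≢j
      with crossed p k σ'p<σ'q
    ...   | inj₁ p<k          = inj₁ (<-trans p<k k<j)
    ...   | inj₂ (_ , k<σk)   = ⊥-elim (ℕ.<⇒≱ k<σk σk≤k)
    crossed′ crossed p q σ'p<σ'q | other p≢k p≢j | other q≢k q≢j
      rewrite swapAt-other k j p σ p≢k p≢j | swapAt-other k j q σ q≢k q≢j =
        crossed p q σ'p<σ'q

  invariants : {σ : Assignment n} → SwapSeq P σ → RouteDominated σ × InversionsCrossed σ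
  invariants start = (λ p i → ⊥-elim ∘′ OnRoute-empty) , (λ p q → inj₁)
  invariants (step s record { i = k ; j = j ; adjacent = adj ; pref-i = pref-k
                            ; pref-j = pref-j ; result = refl })
    with invariants s
  ... | dominated , crossed = dominated′ , crossed′ crossed
    where open AdjacentSwap _ k j adj pref-k pref-j dominated

lemma3 : {n : ℕ} (P : Profile n) (σ : Assignment n) → SwapSeq P σ →
    (a b a' b' : Fin n) → a < b →
    σ a' ≡ a → σ b' ≡ b →
    (a' ≤ a ⊎ b' ≥ b) → a' < b'
lemma3 P σ s a b a' b' a<b refl refl a'≤a⊎b'≥b
  with proj₂ (Invariants.invariants P s) a' b' a<b
... | inj₁ a'<b'         = a'<b'
... | inj₂ (a<a' , b'<b) = ⊥-elim ([ ℕ.<⇒≱ a<a' , ℕ.<⇒≱ b'<b ]′ a'≤a⊎b'≥b)
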